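{- Let $\mathcal C$ be a $\le$-antichain of finite, regular, subdirectly irreducible Heyting algebras. Then for all $\mathcal I,\mathcal J\subseteq\mathcal C$ with $\mathcal I\neq\mathcal J$ we have $Log^\neg(\mathcal I)\neq Log^\neg(\mathcal J)$.
   Context: For Heyting algebras $A,B$, $A\le B$ means $A\in\mathbb{HS}(B)$, i.e. $A$ is a homomorphic image of a subalgebra of $B$. A Heyting algebra is regular if it is generated by its regular elements $x=\neg\neg x$. A valuation $\mu:\mathrm{At}\to H$ is negative if $\mu(p)$ is regular for every atom $p$; $H\vDash^\neg\phi$ means that $\phi$ (a formula built from atoms with $\bot,\top,\land,\lor,\to$) evaluates to $1$ under every negative valuation; for a class $\mathcal K$, $Log^\neg(\mathcal K)=\{\phi: H\vDash^\neg\phi \text{ for all } H\in\mathcal K\}$. -}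

module Defs where

open import Level using (0ℓ)
open import Data.Nat using (ℕ)
open import Data.Fin using (Fin)
open import Data.Product using (Σ; Σ-syntax; ∃; _×_; _,_; proj₁)
open import Relation.Nullary using (¬_)
open import Relation.Unary using (Pred; _∈_)
open import Relation.Binary using (Rel; IsEquivalence)
open import Relation.Binary.PropositionalEquality as ≡ using (_≡_)
open import Relation.Binary.Lattice.Bundles using (HeytingAlgebra)
open import Function.Bundles using (Inverse)

HA : Set₁
HA = HeytingAlgebra 0ℓ 0ℓ 0ℓ

module _ (H : HA) where
  open HeytingAlgebra H

  neg : Carrier → Carrier
  neg x = x ⇨ ⊥

  IsRegularElem : Carrier → Set
  IsRegularElem x = neg (neg x) ≈ x

  data GenByRegular : Carrier → Set where
    gen-reg : ∀ {x} → IsRegularElem x → GenByRegular x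
    gen-⊤   : GenByRegular ⊤
    gen-⊥   : GenByRegular ⊥
    gen-∧   : ∀ {x y} → GenByRegular x → GenByRegular y → GenByRegular (x ∧ y)
    gen-∨   : ∀ {x y} → GenByRegular x → GenByRegular y → GenByRegular (x ∨ y)
    gen-⇨   : ∀ {x y} → GenByRegular x → GenByRegular y → GenByRegular (x ⇨ y)

  Regular : Set
  Regular = ∀ x → GenByRegular x

  Finite : Set
  Finite = Σ[ n ∈ ℕ ] Inverse (HeytingAlgebra.setoid H) (≡.setoid (Fin n))

  record Congruence : Set₁ where
    field
      θ       : Rel Carrier 0ℓ
      isEquiv : IsEquivalence θ
      ≈⇒θ     : ∀ {x y} → x ≈ y → θ x y
      ∧-cong  : ∀ {x x' y y'} → θ x x' → θ y y' → θ (x ∧ y) (x' ∧ y')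
      ∨-cong  : ∀ {x x' y y'} → θ x x' → θ y y' → θ (x ∨ y) (x' ∨ y')
      ⇨-cong  : ∀ {x x' y y'} → θ x x' → θ y y' → θ (x ⇨ y) (x' ⇨ y')

  -- subdirectly irreducible: there is a pair a ≉ b identified by every
  -- congruence other than the identity congruence (i.e. H is nontrivial and
  -- has a least non-identity congruence, the monolith).
  SubdirectlyIrreducible : Set₁
  SubdirectlyIrreducible =
    Σ[ a ∈ Carrier ] Σ[ b ∈ Carrier ] (¬ (a ≈ b) ×
      ((Θ : Congruence) →
        (Σ[ x ∈ Carrier ] Σ[ y ∈ Carrier ] (Congruence.θ Θ x y × ¬ (x ≈ y))) →
        Congruence.θ Θ a b))

-- A ≤ B  iff  A ∈ HS(B): there is a subalgebra S of B (a subset closed under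
-- the Heyting operations) and a surjective homomorphism S → A.
record _≼_ (A B : HA) : Set₁ where
  module A = HeytingAlgebra A
  module B = HeytingAlgebra B
  field
    S     : Pred B.Carrier 0ℓ
    S-⊤   : B.⊤ ∈ S
    S-⊥   : B.⊥ ∈ S
    S-∧   : ∀ {x y} → x ∈ S → y ∈ S → (x B.∧ y) ∈ S
    S-∨   : ∀ {x y} → x ∈ S → y ∈ S → (x B.∨ y) ∈ S
    S-⇨   : ∀ {x y} → x ∈ S → y ∈ S → (x B.⇨ y) ∈ S
    h     : (x : B.Carrier) → x ∈ S → A.Carrier
    h-cong : ∀ {x y} (p : x ∈ S) (q : y ∈ S) → x B.≈ y → h x p A.≈ h y q
    h-⊤   : h B.⊤ S-⊤ A.≈ A.⊤
    h-⊥   : h B.⊥ S-⊥ A.≈ A.⊥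
    h-∧   : ∀ {x y} (p : x ∈ S) (q : y ∈ S) → h (x B.∧ y) (S-∧ p q) A.≈ (h x p A.∧ h y q)
    h-∨   : ∀ {x y} (p : x ∈ S) (q : y ∈ S) → h (x B.∨ y) (S-∨ p q) A.≈ (h x p A.∨ h y q)
    h-⇨   : ∀ {x y} (p : x ∈ S) (q : y ∈ S) → h (x B.⇨ y) (S-⇨ p q) A.≈ (h x p A.⇨ h y q)
    h-surj : ∀ a → Σ[ x ∈ B.Carrier ] Σ[ p ∈ x ∈ S ] (h x p A.≈ a)

data Formula : Set where
  var  : ℕ → Formula
  `⊥ `⊤ : Formula
  _`∧_ _`∨_ _`→_ : Formula → Formula → Formula

module _ (H : HA) where
  open HeytingAlgebra H

  ⟦_⟧ : Formula → (ℕ → Carrier) → Carrier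
  ⟦ var p ⟧ μ = μ p
  ⟦ `⊥ ⟧ μ = ⊥
  ⟦ `⊤ ⟧ μ = ⊤
  ⟦ φ `∧ ψ ⟧ μ = ⟦ φ ⟧ μ ∧ ⟦ ψ ⟧ μ
  ⟦ φ `∨ ψ ⟧ μ = ⟦ φ ⟧ μ ∨ ⟦ ψ ⟧ μ
  ⟦ φ `→ ψ ⟧ μ = ⟦ φ ⟧ μ ⇨ ⟦ ψ ⟧ μ

  NegativeValuation : (ℕ → Carrier) → Set
  NegativeValuation μ = ∀ p → IsRegularElem H (μ p)

  _⊨¬_ : Formula → Set
  _⊨¬_ φ = (μ : ℕ → Carrier) → NegativeValuation μ → ⟦ φ ⟧ μ ≈ ⊤

LogNeg : {Idx : Set} → (C : Idx → HA) → Pred Idx 0ℓ → Pred Formula 0ℓ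
LogNeg C 𝓘 φ = ∀ i → i ∈ 𝓘 → _⊨¬_ (C i) φ

Antichain : {Idx : Set} → (Idx → HA) → Set₁
Antichain {Idx} C = ∀ (i j : Idx) → ¬ (i ≡ j) → ¬ (C i ≼ C j)

{-# OPTIONS --safe #-}
-- The negative Jankov formula χ(A) of a finite, regular, subdirectly
-- irreducible A says: if the atoms, read as the elements of A, obey the
-- operation tables of A, then the monolith pair a, b coincides.  Regularity
-- lets every element be written as a term in atoms valued by regular
-- elements, so a negative valuation refutes χ(A) in A.  Conversely, if μ
-- refutes χ(A) in a finite B and d is the value of the tables, then modulo
-- the filter ↑d the map x ↦ ⟦x⟧μ is a homomorphism A → B whose kernel misses
-- (a, b), hence is trivial because A is subdirectly irreducible; the elements
-- of B equal modulo d to some ⟦x⟧μ then form a subalgebra mapping onto A, so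
-- A ≼ B.  In an antichain, χ(C i) for i ∈ 𝓘 ∖ 𝓙 thus lies in Log¬(𝓙) but not
-- in Log¬(𝓘).
module Submission where

open import Defs hiding (⟦_⟧)
open import Level using (0ℓ)
open import Data.Product using (Σ-syntax; _×_; _,_; proj₁; proj₂)
open import Data.Sum using (_⊎_; inj₁; inj₂)
open import Data.Nat as ℕ using (ℕ; zero; suc)
open import Data.Fin using (Fin; toℕ; fromℕ<)
open import Data.Fin.Properties using (_≟_; toℕ<n; fromℕ<-toℕ)
open import Function using (_∘_)
open import Function.Bundles using (_⇔_; Inverse; Equivalence)
open import Function.Properties.Inverse using (Inverse⇒Injection)
open import Relation.Nullary using (¬_; yes; no; contradiction)
open import Relation.Nullary.Decidable using (via-injection; decidable-stable)
open import Relation.Unary using (Pred; _∈_; _∉_; _⊆_)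
open import Relation.Binary.Definitions using (Decidable)
open import Relation.Binary.PropositionalEquality as ≡ using (_≡_)
open import Relation.Binary.Lattice.Bundles using (HeytingAlgebra)

module HeytingAlgebraProperties (H : HA) where
  open HeytingAlgebra H public
  open import Relation.Binary.Lattice.Properties.HeytingAlgebra H public
    using (⇨-eval; ⇨-cong; ⇨ˡ-contravariant; x≤¬¬x; ∧-distribˡ-∨-≤)
  open import Relation.Binary.Lattice.Properties.MeetSemilattice meetSemilattice public
    using (∧-monotonic; ∧-cong)
  open import Relation.Binary.Lattice.Properties.JoinSemilattice joinSemilattice public
    using (∨-monotonic; ∨-cong)

  ⟦_⟧ : Formula → (ℕ → Carrier) → Carrier
  ⟦_⟧ = Defs.⟦_⟧ H

  infix 5 _↔_
  _↔_ : Carrier → Carrier → Carrier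
  x ↔ y = (x ⇨ y) ∧ (y ⇨ x)

  ⊤≤⇒≈⊤ : ∀ {x} → ⊤ ≤ x → x ≈ ⊤
  ⊤≤⇒≈⊤ {x} = antisym (maximum x)

  ¬¬¬x≈¬x : ∀ x → neg H (neg H (neg H x)) ≈ neg H x
  ¬¬¬x≈¬x x = antisym (⇨ˡ-contravariant (x≤¬¬x x)) (x≤¬¬x (neg H x))

  -- x ∼ y is equality in the quotient H / ↑d.
  module Modulo (d : Carrier) where
    infix 4 _≤ᵈ_ _∼_

    _≤ᵈ_ : Carrier → Carrier → Set
    x ≤ᵈ y = d ∧ x ≤ y

    _∼_ : Carrier → Carrier → Set
    x ∼ y = x ≤ᵈ y × y ≤ᵈ x

    ≤ᵈ-trans : ∀ {x y z} → x ≤ᵈ y → y ≤ᵈ z → x ≤ᵈ z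
    ≤ᵈ-trans {x} p q = trans (∧-greatest (x∧y≤x d x) p) q

    ≈⇒≤ᵈ : ∀ {x y} → x ≈ y → x ≤ᵈ y
    ≈⇒≤ᵈ e = trans (x∧y≤y _ _) (reflexive e)

    ∧-mono-≤ᵈ : ∀ {x x' y y'} → x ≤ᵈ x' → y ≤ᵈ y' → x ∧ y ≤ᵈ x' ∧ y'
    ∧-mono-≤ᵈ {x} {_} {y} p q =
      ∧-greatest (trans (∧-monotonic refl (x∧y≤x x y)) p)
                 (trans (∧-monotonic refl (x∧y≤y x y)) q)

    ∨-mono-≤ᵈ : ∀ {x x' y y'} → x ≤ᵈ x' → y ≤ᵈ y' → x ∨ y ≤ᵈ x' ∨ y'
    ∨-mono-≤ᵈ {x} {_} {y} p q = trans (∧-distribˡ-∨-≤ d x y) (∨-monotonic p q)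

    ⇨-mono-≤ᵈ : ∀ {x x' y y'} → x' ≤ᵈ x → y ≤ᵈ y' → x ⇨ y ≤ᵈ x' ⇨ y'
    ⇨-mono-≤ᵈ {x} {x'} {y} p q = transpose-⇨ (trans (∧-greatest ≤d ≤y) q)
      where
        ≤d : (d ∧ (x ⇨ y)) ∧ x' ≤ d
        ≤d = trans (x∧y≤x _ _) (x∧y≤x _ _)
        ≤x : (d ∧ (x ⇨ y)) ∧ x' ≤ x
        ≤x = trans (∧-greatest ≤d (x∧y≤y _ _)) p
        ≤y : (d ∧ (x ⇨ y)) ∧ x' ≤ y
        ≤y = trans (∧-greatest (trans (x∧y≤x _ _) (x∧y≤y _ _)) ≤x) ⇨-eval

    ∼-refl : ∀ {x} → x ∼ x
    ∼-refl {x} = x∧y≤y d x , x∧y≤y d x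

    ∼-sym : ∀ {x y} → x ∼ y → y ∼ x
    ∼-sym (p , q) = q , p

    ∼-trans : ∀ {x y z} → x ∼ y → y ∼ z → x ∼ z
    ∼-trans (p , q) (p' , q') = ≤ᵈ-trans p p' , ≤ᵈ-trans q' q

    ≈⇒∼ : ∀ {x y} → x ≈ y → x ∼ y
    ≈⇒∼ e = ≈⇒≤ᵈ e , ≈⇒≤ᵈ (Eq.sym e)

    ∧-resp-∼ : ∀ {x x' y y'} → x ∼ x' → y ∼ y' → x ∧ y ∼ x' ∧ y'
    ∧-resp-∼ (p , q) (p' , q') = ∧-mono-≤ᵈ p p' , ∧-mono-≤ᵈ q q'

    ∨-resp-∼ : ∀ {x x' y y'} → x ∼ x' → y ∼ y' → x ∨ y ∼ x' ∨ y'
    ∨-resp-∼ (p , q) (p' , q') = ∨-mono-≤ᵈ p p' , ∨-mono-≤ᵈ q q'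

    ⇨-resp-∼ : ∀ {x x' y y'} → x ∼ x' → y ∼ y' → x ⇨ y ∼ x' ⇨ y'
    ⇨-resp-∼ (p , q) (p' , q') = ⇨-mono-≤ᵈ q p' , ⇨-mono-≤ᵈ p q'

    ∼⇒≤↔ : ∀ {x y} → x ∼ y → d ≤ x ↔ y
    ∼⇒≤↔ (p , q) = ∧-greatest (transpose-⇨ p) (transpose-⇨ q)

    ≤↔⇒∼ : ∀ {x y} → d ≤ x ↔ y → x ∼ y
    ≤↔⇒∼ e = transpose-∧ (trans e (x∧y≤x _ _)) , transpose-∧ (trans e (x∧y≤y _ _))

  ≈⇒⊤≤↔ : ∀ {x y} → x ≈ y → ⊤ ≤ x ↔ y
  ≈⇒⊤≤↔ = ∼⇒≤↔ ∘ ≈⇒∼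
    where open Modulo ⊤

  ⊤≤↔⇒≈ : ∀ {x y} → ⊤ ≤ x ↔ y → x ≈ y
  ⊤≤↔⇒≈ e = let p , q = ≤↔⇒∼ e in antisym (below p) (below q)
    where
      open Modulo ⊤
      below : ∀ {u v} → u ≤ᵈ v → u ≤ v
      below = trans (∧-greatest (maximum _) refl)

Finite⇒≈-dec : ∀ {H} → Finite H → Decidable (HeytingAlgebra._≈_ H)
Finite⇒≈-dec (_ , I) = via-injection (Inverse⇒Injection I) _≟_

infix 15 _`↔_
_`↔_ : Formula → Formula → Formula
φ `↔ ψ = (φ `→ ψ) `∧ (ψ `→ φ)

⋀ : ∀ {n} → (Fin n → Formula) → Formula
⋀ {zero}  φ = `⊤
⋀ {suc n} φ = φ Fin.zero `∧ ⋀ (φ ∘ Fin.suc)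

module _ {H : HA} where
  open HeytingAlgebraProperties H

  ⟦⋀⟧≤ : ∀ {n} (φ : Fin n → Formula) (k : Fin n) μ → ⟦ ⋀ φ ⟧ μ ≤ ⟦ φ k ⟧ μ
  ⟦⋀⟧≤ φ Fin.zero    μ = x∧y≤x _ _
  ⟦⋀⟧≤ φ (Fin.suc k) μ = trans (x∧y≤y _ _) (⟦⋀⟧≤ (φ ∘ Fin.suc) k μ)

  ≤⟦⋀⟧ : ∀ {n} (φ : Fin n → Formula) {w} μ → (∀ k → w ≤ ⟦ φ k ⟧ μ) → w ≤ ⟦ ⋀ φ ⟧ μ
  ≤⟦⋀⟧ {zero}  φ μ w≤ = maximum _
  ≤⟦⋀⟧ {suc n} φ μ w≤ = ∧-greatest (w≤ Fin.zero) (≤⟦⋀⟧ (φ ∘ Fin.suc) μ (w≤ ∘ Fin.suc))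

  generatingTerm : (Carrier → ℕ) → ∀ {x} → GenByRegular H x → Formula
  generatingTerm code (gen-reg {x} _) = var (code x)
  generatingTerm code gen-⊤           = `⊤
  generatingTerm code gen-⊥           = `⊥
  generatingTerm code (gen-∧ g h)     = generatingTerm code g `∧ generatingTerm code h
  generatingTerm code (gen-∨ g h)     = generatingTerm code g `∨ generatingTerm code h
  generatingTerm code (gen-⇨ g h)     = generatingTerm code g `→ generatingTerm code h

  ⟦generatingTerm⟧ : ∀ {code μ} → (∀ {x} → IsRegularElem H x → μ (code x) ≈ x) →
                     ∀ {x} (g : GenByRegular H x) → ⟦ generatingTerm code g ⟧ μ ≈ x
  ⟦generatingTerm⟧ decodes (gen-reg r)  = decodes r
  ⟦generatingTerm⟧ decodes gen-⊤        = Eq.refl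
  ⟦generatingTerm⟧ decodes gen-⊥        = Eq.refl
  ⟦generatingTerm⟧ decodes (gen-∧ g h)  = ∧-cong (⟦generatingTerm⟧ decodes g) (⟦generatingTerm⟧ decodes h)
  ⟦generatingTerm⟧ decodes (gen-∨ g h)  = ∨-cong (⟦generatingTerm⟧ decodes g) (⟦generatingTerm⟧ decodes h)
  ⟦generatingTerm⟧ decodes (gen-⇨ g h)  = ⇨-cong (⟦generatingTerm⟧ decodes g) (⟦generatingTerm⟧ decodes h)

  avoids-monolith⇒trivial : (si : SubdirectlyIrreducible H) → Decidable _≈_ →
    (Θ : Congruence H) → ¬ Congruence.θ Θ (proj₁ si) (proj₁ (proj₂ si)) →
    ∀ {x y} → Congruence.θ Θ x y → x ≈ y
  avoids-monolith⇒trivial (_ , _ , _ , least) _≈?_ Θ ¬θab {x} {y} θxy =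
    decidable-stable (x ≈? y) (λ x≉y → ¬θab (least Θ (x , y , θxy , x≉y)))

record HomomorphismModulo (A B : HA) (d : HeytingAlgebra.Carrier B) : Set where
  private
    module A = HeytingAlgebraProperties A
    module B = HeytingAlgebraProperties B
  open B.Modulo d
  field
    f      : A.Carrier → B.Carrier
    f-cong : ∀ {x y} → x A.≈ y → f x ∼ f y
    f-⊤    : f A.⊤ ∼ B.⊤
    f-⊥    : f A.⊥ ∼ B.⊥
    f-∧    : ∀ x y → f (x A.∧ y) ∼ f x B.∧ f y
    f-∨    : ∀ x y → f (x A.∨ y) ∼ f x B.∨ f y
    f-⇨    : ∀ x y → f (x A.⇨ y) ∼ f x B.⇨ f y

  private
    compatible : ∀ {_∘_ : A.Carrier → A.Carrier → A.Carrier} {_∙_ : B.Carrier → B.Carrier → B.Carrier} →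
      (∀ {u u' v v'} → u ∼ u' → v ∼ v' → u ∙ v ∼ u' ∙ v') →
      (∀ x y → f (x ∘ y) ∼ f x ∙ f y) →
      ∀ {x x' y y'} → f x ∼ f x' → f y ∼ f y' → f (x ∘ y) ∼ f (x' ∘ y')
    compatible ∙-resp f-∘ {x} {x'} {y} {y'} p q =
      ∼-trans (f-∘ x y) (∼-trans (∙-resp p q) (∼-sym (f-∘ x' y')))

  kernel : Congruence A
  kernel = record
    { θ       = λ x y → f x ∼ f y
    ; isEquiv = record { refl = ∼-refl ; sym = ∼-sym ; trans = ∼-trans }
    ; ≈⇒θ     = f-cong
    ; ∧-cong  = compatible ∧-resp-∼ f-∧
    ; ∨-cong  = compatible ∨-resp-∼ f-∨
    ; ⇨-cong  = compatible ⇨-resp-∼ f-⇨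
    }

  injective⇒≼ : (∀ {x y} → f x ∼ f y → x A.≈ y) → A ≼ B
  injective⇒≼ injective = record
    { S      = λ u → Σ[ x ∈ A.Carrier ] u ∼ f x
    ; S-⊤    = A.⊤ , ∼-sym f-⊤
    ; S-⊥    = A.⊥ , ∼-sym f-⊥
    ; S-∧    = λ { (x , p) (y , q) → x A.∧ y , ∼-trans (∧-resp-∼ p q) (∼-sym (f-∧ x y)) }
    ; S-∨    = λ { (x , p) (y , q) → x A.∨ y , ∼-trans (∨-resp-∼ p q) (∼-sym (f-∨ x y)) }
    ; S-⇨    = λ { (x , p) (y , q) → x A.⇨ y , ∼-trans (⇨-resp-∼ p q) (∼-sym (f-⇨ x y)) }
    ; h      = λ _ → proj₁
    ; h-cong = λ { (_ , p) (_ , q) e → injective (∼-trans (∼-sym p) (∼-trans (≈⇒∼ e) q)) }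
    ; h-⊤    = A.Eq.refl
    ; h-⊥    = A.Eq.refl
    ; h-∧    = λ _ _ → A.Eq.refl
    ; h-∨    = λ _ _ → A.Eq.refl
    ; h-⇨    = λ _ _ → A.Eq.refl
    ; h-surj = λ x → f x , (x , ∼-refl) , A.Eq.refl
    }

module NegativeJankovFormula (A : HA) (finA : Finite A) (regA : Regular A)
                             (siA : SubdirectlyIrreducible A) where
  private
    module A = HeytingAlgebraProperties A
    n = proj₁ finA
    open Inverse (proj₂ finA) using (strictlyInverseʳ)
      renaming (to to index; from to element; to-cong to index-cong)

  a b : A.Carrier
  a = proj₁ siA
  b = proj₁ (proj₂ siA)

  -- The atom toℕ (index y) stands for the regular element y.
  ⌜_⌝ : A.Carrier → Formula
  ⌜ x ⌝ = generatingTerm (toℕ ∘ index) (regA (element (index x)))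

  ⌜⌝-cong : ∀ {x y} → x A.≈ y → ⌜ x ⌝ ≡ ⌜ y ⌝
  ⌜⌝-cong = ≡.cong (λ k → generatingTerm (toℕ ∘ index) (regA (element k))) ∘ index-cong

  preserves : (A.Carrier → A.Carrier → A.Carrier) → (Formula → Formula → Formula) →
              A.Carrier → A.Carrier → Formula
  preserves _∘_ _∘ᶠ_ x y = ⌜ x ∘ y ⌝ `↔ ⌜ x ⌝ ∘ᶠ ⌜ y ⌝

  homomorphismAt : A.Carrier → A.Carrier → Formula
  homomorphismAt x y =
    preserves A._∧_ _`∧_ x y `∧ (preserves A._∨_ _`∨_ x y `∧ preserves A._⇨_ _`→_ x y)

  homomorphismAt-cong : ∀ {x x' y y'} → x A.≈ x' → y A.≈ y' →
                        homomorphismAt x y ≡ homomorphismAt x' y'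
  homomorphismAt-cong e e' =
    ≡.cong₂ _`∧_ (preserves-cong A.∧-cong _`∧_)
                 (≡.cong₂ _`∧_ (preserves-cong A.∨-cong _`∨_) (preserves-cong A.⇨-cong _`→_))
    where
      preserves-cong : ∀ {_∘_} → (∀ {u u' v v'} → u A.≈ u' → v A.≈ v' → (u ∘ v) A.≈ (u' ∘ v')) →
                       ∀ _∘ᶠ_ → preserves _∘_ _∘ᶠ_ _ _ ≡ preserves _∘_ _∘ᶠ_ _ _
      preserves-cong ∘-cong _∘ᶠ_ =
        ≡.cong₂ _`↔_ (⌜⌝-cong (∘-cong e e')) (≡.cong₂ _∘ᶠ_ (⌜⌝-cong e) (⌜⌝-cong e'))

  diagram : Formula
  diagram = (⌜ A.⊤ ⌝ `↔ `⊤) `∧ ((⌜ A.⊥ ⌝ `↔ `⊥) `∧ ⋀ λ k → ⋀ λ l → homomorphismAt (element k) (element l))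

  jankov : Formula
  jankov = diagram `→ (⌜ a ⌝ `↔ ⌜ b ⌝)

  decode : ℕ → A.Carrier
  decode p with p ℕ.<? n
  ... | yes p<n = element (fromℕ< p<n)
  ... | no _    = A.⊤

  decode-toℕ : ∀ k → decode (toℕ k) A.≈ element k
  decode-toℕ k with toℕ k ℕ.<? n
  ... | yes k<n = A.Eq.reflexive (≡.cong element (fromℕ<-toℕ k k<n))
  ... | no k≮n  = contradiction (toℕ<n k) k≮n

  -- ¬¬ makes the valuation negative and fixes the atoms that name regular elements.
  canonical : ℕ → A.Carrier
  canonical p = neg A (neg A (decode p))

  canonical-negative : NegativeValuation A canonical
  canonical-negative p = A.¬¬¬x≈¬x (neg A (decode p))

  ⟦⌜⌝⟧-canonical : ∀ x → A.⟦ ⌜ x ⌝ ⟧ canonical A.≈ x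
  ⟦⌜⌝⟧-canonical x = A.Eq.trans (⟦generatingTerm⟧ decodes (regA _)) (strictlyInverseʳ x)
    where
      decodes : ∀ {y} → IsRegularElem A y → canonical (toℕ (index y)) A.≈ y
      decodes {y} y-regular = A.Eq.trans
        (A.⇨-cong (A.⇨-cong (A.Eq.trans (decode-toℕ (index y)) (strictlyInverseʳ y)) A.Eq.refl) A.Eq.refl)
        y-regular

  diagram-canonical : A.⊤ A.≤ A.⟦ diagram ⟧ canonical
  diagram-canonical =
    A.∧-greatest (A.≈⇒⊤≤↔ (⟦⌜⌝⟧-canonical A.⊤)) (A.∧-greatest (A.≈⇒⊤≤↔ (⟦⌜⌝⟧-canonical A.⊥))
      (≤⟦⋀⟧ {A} _ canonical λ k → ≤⟦⋀⟧ {A} _ canonical λ l →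
        A.∧-greatest (preserved A._∧_ A.∧-cong k l)
          (A.∧-greatest (preserved A._∨_ A.∨-cong k l) (preserved A._⇨_ A.⇨-cong k l))))
    where
      preserved : ∀ _∘_ → (∀ {u u' v v'} → u A.≈ u' → v A.≈ v' → (u ∘ v) A.≈ (u' ∘ v')) → ∀ k l →
        let x = element k ; y = element l in
        A.⊤ A.≤ A.⟦ ⌜ x ∘ y ⌝ ⟧ canonical A.↔ (A.⟦ ⌜ x ⌝ ⟧ canonical ∘ A.⟦ ⌜ y ⌝ ⟧ canonical)
      preserved _ ∘-cong k l = A.≈⇒⊤≤↔ (A.Eq.trans (⟦⌜⌝⟧-canonical _)
        (A.Eq.sym (∘-cong (⟦⌜⌝⟧-canonical (element k)) (⟦⌜⌝⟧-canonical (element l)))))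

  jankov-refuted : ¬ (_⊨¬_ A jankov)
  jankov-refuted valid = a≉b (begin
    a                            ≈⟨ ⟦⌜⌝⟧-canonical a ⟨
    A.⟦ ⌜ a ⌝ ⟧ canonical       ≈⟨ A.⊤≤↔⇒≈ ⊤≤⌜a⌝↔⌜b⌝ ⟩
    A.⟦ ⌜ b ⌝ ⟧ canonical       ≈⟨ ⟦⌜⌝⟧-canonical b ⟩
    b                            ∎)
    where
      open import Relation.Binary.Reasoning.Setoid A.setoid
      a≉b : ¬ (a A.≈ b)
      a≉b = proj₁ (proj₂ (proj₂ siA))
      ⊤≤⌜a⌝↔⌜b⌝ : A.⊤ A.≤ A.⟦ ⌜ a ⌝ ⟧ canonical A.↔ A.⟦ ⌜ b ⌝ ⟧ canonical
      ⊤≤⌜a⌝↔⌜b⌝ = A.trans (A.∧-greatest A.refl diagram-canonical)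
                          (A.transpose-∧ (A.reflexive (A.Eq.sym (valid canonical canonical-negative))))

  module _ (B : HA) (μ : ℕ → HeytingAlgebra.Carrier B) where
    private
      module B = HeytingAlgebraProperties B
      d = B.⟦ diagram ⟧ μ
    open B.Modulo d

    d≤homomorphismAt : ∀ x y → d B.≤ B.⟦ homomorphismAt x y ⟧ μ
    d≤homomorphismAt x y =
      ≡.subst (λ φ → d B.≤ B.⟦ φ ⟧ μ) (homomorphismAt-cong (strictlyInverseʳ x) (strictlyInverseʳ y))
        (B.trans (B.x∧y≤y _ _) (B.trans (B.x∧y≤y _ _)
          (B.trans (⟦⋀⟧≤ {B} _ (index x) μ) (⟦⋀⟧≤ {B} _ (index y) μ))))

    diagram-homomorphism : HomomorphismModulo A B d
    diagram-homomorphism = record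
      { f      = λ x → B.⟦ ⌜ x ⌝ ⟧ μ
      ; f-cong = λ e → ≈⇒∼ (B.Eq.reflexive (≡.cong (λ φ → B.⟦ φ ⟧ μ) (⌜⌝-cong e)))
      ; f-⊤    = ≤↔⇒∼ (B.x∧y≤x _ _)
      ; f-⊥    = ≤↔⇒∼ (B.trans (B.x∧y≤y _ _) (B.x∧y≤x _ _))
      ; f-∧    = λ x y → ≤↔⇒∼ (B.trans (d≤homomorphismAt x y) (B.x∧y≤x _ _))
      ; f-∨    = λ x y → ≤↔⇒∼ (B.trans (d≤homomorphismAt x y) (B.trans (B.x∧y≤y _ _) (B.x∧y≤x _ _)))
      ; f-⇨    = λ x y → ≤↔⇒∼ (B.trans (d≤homomorphismAt x y) (B.trans (B.x∧y≤y _ _) (B.x∧y≤y _ _)))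
      }

    refutation⇒≼ : ¬ (B.⟦ jankov ⟧ μ B.≈ B.⊤) → A ≼ B
    refutation⇒≼ refuted =
      injective⇒≼ (avoids-monolith⇒trivial siA (Finite⇒≈-dec {A} finA) kernel fa≁fb)
      where
        open HomomorphismModulo diagram-homomorphism
        fa≁fb : ¬ f a ∼ f b
        fa≁fb fa∼fb = refuted (B.⊤≤⇒≈⊤ (B.transpose-⇨ (B.trans (B.x∧y≤y _ _) (∼⇒≤↔ fa∼fb))))

  module _ (B : HA) (finB : Finite B) (A⋠B : ¬ (A ≼ B)) where
    private
      module B = HeytingAlgebraProperties B

    jankov-true : ∀ μ → B.⟦ jankov ⟧ μ B.≈ B.⊤
    jankov-true μ = decidable-stable (Finite⇒≈-dec {B} finB _ _) (A⋠B ∘ refutation⇒≼ B μ)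

antichain-separates : {Idx : Set} {C : Idx → HA} → Antichain C →
  ∀ {𝓚 : Pred Idx 0ℓ} {i j} → i ∉ 𝓚 → j ∈ 𝓚 → ¬ (C i ≼ C j)
antichain-separates antichain i∉𝓚 j∈𝓚 = antichain _ _ (λ { ≡.refl → i∉𝓚 j∈𝓚 })

LogNeg-separates : {Idx : Set} (C : Idx → HA) → (∀ j → Finite (C j)) →
  ∀ {i} → Regular (C i) → SubdirectlyIrreducible (C i) →
  ∀ {𝓘 𝓙 : Pred Idx 0ℓ} → i ∈ 𝓘 → (∀ {j} → j ∈ 𝓙 → ¬ (C i ≼ C j)) →
  ¬ (LogNeg C 𝓙 ⊆ LogNeg C 𝓘)
LogNeg-separates C fin {i} reg si i∈𝓘 not-below 𝓙⊆𝓘 =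
  jankov-refuted (𝓙⊆𝓘 {jankov} (λ j j∈𝓙 μ _ → jankov-true (C j) (fin j) (not-below j∈𝓙) μ) i i∈𝓘)
  where open NegativeJankovFormula (C i) (fin i) reg si

proposition4p3 : {Idx : Set} (C : Idx → HA)
    → (∀ i → Finite (C i)) → (∀ i → Regular (C i)) → (∀ i → SubdirectlyIrreducible (C i))
    → Antichain C
    → (𝓘 𝓙 : Pred Idx 0ℓ)
    → (Σ[ i ∈ Idx ] ((i ∈ 𝓘 × i ∉ 𝓙) ⊎ (i ∈ 𝓙 × i ∉ 𝓘)))
    → ¬ (∀ φ → (φ ∈ LogNeg C 𝓘) ⇔ (φ ∈ LogNeg C 𝓙))
proposition4p3 C fin reg si antichain 𝓘 𝓙 (i , inj₁ (i∈𝓘 , i∉𝓙)) 𝓘≗𝓙 =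
  LogNeg-separates C fin (reg i) (si i) i∈𝓘 (antichain-separates antichain i∉𝓙)
    (λ {φ} → Equivalence.from (𝓘≗𝓙 φ))
proposition4p3 C fin reg si antichain 𝓘 𝓙 (i , inj₂ (i∈𝓙 , i∉𝓘)) 𝓘≗𝓙 =
  LogNeg-separates C fin (reg i) (si i) i∈𝓙 (antichain-separates antichain i∉𝓘)
    (λ {φ} → Equivalence.to (𝓘≗𝓙 φ))
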